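{- Let $R(\mathbf{x},\mathbf{x}')$ be a balanced difference bounds constraint, let $n\ge1$, and let $\rho$ be a path in $\mathcal{G}_R^n$ with $\mathrm{positions}(\rho)=\{a,\dots,b\}$ for some $0\le a\le b\le n$. Then for every $k\in\{ -a,\dots,n-b\}$, the shifted path $\overrightarrow{\rho}^{(k)}$ is a path in $\mathcal{G}_R^n$ and $\mathrm{positions}(\overrightarrow{\rho}^{(k)})=\{a+k,\dots,b+k\}$.
   Context: Variables range over $\mathbb{Z}$; $\mathbf{x}=\{x_1,\dots,x_N\}$. A difference bounds constraint is a finite conjunction of atoms $u-v\le c$, $c\in\mathbb{Z}$; its constraint graph has an edge $u\xrightarrow{c}v$ per atom. $R$ is balanced if $x_i-x_j\le c$ is an atom of $R$ iff $x_i'-x_j'\le c$ is. With fresh copies $x_i^{(p)}$ (position $p$), $\mathcal{G}_R^n$ is the union over $p=0,\dots,n-1$ of the constraint graphs of $R(\mathbf{x}^{(p)},\mathbf{x}^{(p+1)})$. For a path $\rho=x_{i_0}^{(p_0)}\xrightarrow{\alpha_0}\cdots\xrightarrow{\alpha_{m-1}}x_{i_m}^{(p_m)}$, $\mathrm{positions}(\rho)=\{p_0,\dots,p_m\}$, and $\overrightarrow{\rho}^{(k)}$ is the sequence $x_{i_0}^{(p_0+k)}\xrightarrow{\alpha_0}\cdots\xrightarrow{\alpha_{m-1}}x_{i_m}^{(p_m+k)}$. -}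

module Defs where

open import Data.Nat using (ℕ; suc; _≤_; _<_)
open import Data.Integer using (ℤ; +_; ∣_∣) renaming (_+_ to _+ℤ_)
open import Data.Fin using (Fin)
open import Data.List using (List; []; _∷_; map)
open import Data.List.Membership.Propositional using (_∈_)
open import Data.List.Relation.Unary.Any using (Any)
open import Data.Product using (_×_; _,_; proj₁; proj₂)
open import Function.Bundles using (_⇔_)
open import Relation.Binary.PropositionalEquality using (_≡_)

-- Variables of R(x, x'): unprimed x_i (cur i) and primed x_i' (nxt i).
data Var (N : ℕ) : Set where
  cur : Fin N → Var N
  nxt : Fin N → Var N

-- Atom  u - v ≤ c
record Atom (N : ℕ) : Set where
  constructor atom
  field
    lhs : Var N
    rhs : Var N
    bound : ℤ

DBC : ℕ → Set
DBC N = List (Atom N)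

Balanced : ∀ {N} → DBC N → Set
Balanced {N} R = ∀ (i j : Fin N) (c : ℤ) →
  (atom (cur i) (cur j) c ∈ R) ⇔ (atom (nxt i) (nxt j) c ∈ R)

-- Vertices of G_R^n: x_i^{(p)} represented as (i , p).
Vertex : ℕ → Set
Vertex N = Fin N × ℕ

inst : ∀ {N} → ℕ → Var N → Vertex N
inst p (cur i) = i , p
inst p (nxt i) = i , suc p

data Edge {N : ℕ} (R : DBC N) (n : ℕ) : Vertex N → ℤ → Vertex N → Set where
  edge : ∀ {p u v c} → p < n → atom u v c ∈ R → Edge R n (inst p u) c (inst p v)

record Path (N : ℕ) : Set where
  constructor path
  field
    start : Vertex N
    steps : List (ℤ × Vertex N)
open Path public

-- Every step is an edge of G_R^n (and all vertices are vertices of G_R^n, i.e. positions ≤ n).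
ValidFrom : ∀ {N} → DBC N → ℕ → Vertex N → List (ℤ × Vertex N) → Set
ValidFrom R n v [] = proj₂ v ≤ n
ValidFrom R n v ((c , w) ∷ s) = Edge R n v c w × ValidFrom R n w s

IsPathIn : ∀ {N} → DBC N → ℕ → Path N → Set
IsPathIn R n ρ = ValidFrom R n (start ρ) (steps ρ)

vertices : ∀ {N} → Path N → List (Vertex N)
vertices ρ = start ρ ∷ map proj₂ (steps ρ)

_∈Pos_ : ∀ {N} → ℕ → Path N → Set
p ∈Pos ρ = Any (λ v → proj₂ v ≡ p) (vertices ρ)

-- Shift a position by an integer k (used only where p + k ≥ 0).
shiftPos : ℤ → ℕ → ℕ
shiftPos k p = ∣ + p +ℤ k ∣

shiftV : ∀ {N} → ℤ → Vertex N → Vertex N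
shiftV k (i , p) = i , shiftPos k p

shift : ∀ {N} → ℤ → Path N → Path N
shift k (path s st) = path (shiftV k s) (map (λ cw → proj₁ cw , shiftV k (proj₂ cw)) st)

module Submission where

-- Because R is balanced, every "horizontal" atom u - v ≤ c between
--    unprimed (equivalently primed) variables yields an edge at EVERY position
--    0, …, n, while a "vertical" atom between x and x' yields an edge from any
--    position p to p + 1 with p < n.  Hence an edge stays an edge when both of its
--    endpoints are shifted by k, provided the shifted positions lie in {0, …, n};
--    by induction the same holds for whole paths.
--  * Positions.

open import Defs
open import Data.Nat using (ℕ; _≤_; suc; z≤n)
open import Data.Nat.Properties using (n≤1+n)
open import Data.Integer using (ℤ; +_; -_; 0ℤ; ∣_∣; +≤+)
  renaming (_+_ to _+ℤ_; _-_ to _-ℤ_; _≤_ to _≤ℤ_)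
import Data.Integer.Properties as ℤ
open import Algebra.Properties.AbelianGroup ℤ.+-0-abelianGroup
  using (//-rightDividesˡ; //-rightDividesʳ)
open import Data.Product using (_×_; _,_; proj₂; ∃-syntax)
open import Data.List using (List; []; _∷_; map)
open import Data.List.Properties using (map-∘)
open import Data.List.Relation.Unary.Any as Any using (Any; here; there)
open import Data.List.Relation.Unary.All as All using (All; []; _∷_)
open import Data.List.Membership.Propositional using (_∈_)
open import Function.Bundles using (_⇔_; mk⇔; Equivalence)
import Function.Properties.Equivalence as ⇔
open import Relation.Binary.PropositionalEquality
  using (_≡_; refl; sym; trans; cong; subst; module ≡-Reasoning)

shiftPos-correct : ∀ k p → 0ℤ ≤ℤ + p +ℤ k → + shiftPos k p ≡ + p +ℤ k
shiftPos-correct k p = ℤ.0≤i⇒+∣i∣≡i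

-- Shifting commutes with successor on the intended domain; this is why an edge
-- from position p to p + 1 is again such an edge after shifting.
shiftPos-suc : ∀ k p → 0ℤ ≤ℤ + p +ℤ k → shiftPos k (suc p) ≡ suc (shiftPos k p)
shiftPos-suc k p 0≤p+k = ℤ.+-injective (begin
  + shiftPos k (suc p)     ≡⟨ shiftPos-correct k (suc p) 0≤sp+k ⟩
  + suc p +ℤ k             ≡⟨ cong (_+ℤ k) (ℤ.pos-+ 1 p) ⟩
  (+ 1 +ℤ + p) +ℤ k        ≡⟨ ℤ.+-assoc (+ 1) (+ p) k ⟩
  + 1 +ℤ (+ p +ℤ k)        ≡⟨ cong (+ 1 +ℤ_) (shiftPos-correct k p 0≤p+k) ⟨
  + 1 +ℤ + shiftPos k p    ≡⟨ ℤ.pos-+ 1 (shiftPos k p) ⟨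
  + suc (shiftPos k p)     ∎)
  where
  open ≡-Reasoning
  0≤sp+k : 0ℤ ≤ℤ + suc p +ℤ k
  0≤sp+k = ℤ.≤-trans 0≤p+k (ℤ.+-monoˡ-≤ k (+≤+ (n≤1+n p)))

shift-nonneg : ∀ {a k} → - (+ a) ≤ℤ k → ∀ {p} → a ≤ p → 0ℤ ≤ℤ + p +ℤ k
shift-nonneg {a} {k} -a≤k {p} a≤p = begin
  0ℤ               ≡⟨ ℤ.+-inverseʳ (+ a) ⟨
  + a +ℤ - (+ a)   ≤⟨ ℤ.+-mono-≤ (+≤+ a≤p) -a≤k ⟩
  + p +ℤ k         ∎
  where open ℤ.≤-Reasoning

shift-interval : ∀ {a b k} → - (+ a) ≤ℤ k → ∀ p →
  (∃[ q ] (a ≤ q × q ≤ b) × shiftPos k q ≡ p) ⇔ ((+ a) +ℤ k ≤ℤ + p × + p ≤ℤ (+ b) +ℤ k)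
shift-interval {a} {b} {k} -a≤k p = mk⇔ image⊆interval interval⊆image
  where
  image⊆interval : (∃[ q ] (a ≤ q × q ≤ b) × shiftPos k q ≡ p) →
                   (+ a) +ℤ k ≤ℤ + p × + p ≤ℤ (+ b) +ℤ k
  image⊆interval (q , (a≤q , q≤b) , refl) =
    subst ((+ a) +ℤ k ≤ℤ_) (sym q+k) (ℤ.+-monoˡ-≤ k (+≤+ a≤q)) ,
    subst (_≤ℤ (+ b) +ℤ k) (sym q+k) (ℤ.+-monoˡ-≤ k (+≤+ q≤b))
    where
    q+k : + shiftPos k q ≡ + q +ℤ k
    q+k = shiftPos-correct k q (shift-nonneg -a≤k a≤q)

  -- The preimage of p is the position q = p - k.
  interval⊆image : (+ a) +ℤ k ≤ℤ + p × + p ≤ℤ (+ b) +ℤ k →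
                   ∃[ q ] (a ≤ q × q ≤ b) × shiftPos k q ≡ p
  interval⊆image (a+k≤p , p≤b+k) = ∣ + p -ℤ k ∣ , (a≤q , q≤b) , q+k≡p
    where
    a≤p-k : + a ≤ℤ + p -ℤ k
    a≤p-k = subst (_≤ℤ + p -ℤ k) (//-rightDividesʳ k (+ a)) (ℤ.+-monoˡ-≤ (- k) a+k≤p)
    p-k≤b : + p -ℤ k ≤ℤ + b
    p-k≤b = subst (+ p -ℤ k ≤ℤ_) (//-rightDividesʳ k (+ b)) (ℤ.+-monoˡ-≤ (- k) p≤b+k)
    q≡p-k : + ∣ + p -ℤ k ∣ ≡ + p -ℤ k
    q≡p-k = ℤ.0≤i⇒+∣i∣≡i (ℤ.≤-trans (+≤+ z≤n) a≤p-k)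
    a≤q : a ≤ ∣ + p -ℤ k ∣
    a≤q = ℤ.drop‿+≤+ (subst (+ a ≤ℤ_) (sym q≡p-k) a≤p-k)
    q≤b : ∣ + p -ℤ k ∣ ≤ b
    q≤b = ℤ.drop‿+≤+ (subst (_≤ℤ + b) (sym q≡p-k) p-k≤b)
    q+k≡p : shiftPos k ∣ + p -ℤ k ∣ ≡ p
    q+k≡p = cong ∣_∣ (trans (cong (_+ℤ k) q≡p-k) (//-rightDividesˡ k (+ p)))

ShiftFits : ℕ → ℤ → ℕ → Set
ShiftFits n k p = 0ℤ ≤ℤ + p +ℤ k × shiftPos k p ≤ n

interval-fits : ∀ {n a b k} → - (+ a) ≤ℤ k → k ≤ℤ (+ n) -ℤ (+ b) →
                ∀ {q} → a ≤ q × q ≤ b → ShiftFits n k q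
interval-fits {n} {a} {b} {k} -a≤k k≤n-b {q} (a≤q , q≤b) = 0≤q+k , ℤ.drop‿+≤+ q+k≤n
  where
  open ℤ.≤-Reasoning
  0≤q+k : 0ℤ ≤ℤ + q +ℤ k
  0≤q+k = shift-nonneg -a≤k a≤q
  q+k≤n : + shiftPos k q ≤ℤ + n
  q+k≤n = begin
    + shiftPos k q       ≡⟨ shiftPos-correct k q 0≤q+k ⟩
    + q +ℤ k             ≤⟨ ℤ.+-monoˡ-≤ k (+≤+ q≤b) ⟩
    + b +ℤ k             ≡⟨ ℤ.+-comm (+ b) k ⟩
    k +ℤ + b             ≤⟨ ℤ.+-monoˡ-≤ (+ b) k≤n-b ⟩
    (+ n -ℤ + b) +ℤ + b  ≡⟨ //-rightDividesˡ (+ b) (+ n) ⟩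
    + n                  ∎

module _ {N : ℕ} (R : DBC N) (balanced : Balanced R) (n : ℕ) (1≤n : 1 ≤ n) where

  -- Since R is balanced and n ≥ 1, an atom between unprimed variables gives an edge
  -- at every position s ≤ n: through R(x^(s), x^(s+1)) if s < n, and through the
  -- primed copy of the atom in R(x^(s-1), x^(s)) if s > 0.
  horizontal-edge : ∀ {i j c s} → s ≤ n → atom (cur i) (cur j) c ∈ R → Edge R n (i , s) c (j , s)
  horizontal-edge {s = 0}     _   a∈R = edge {p = 0} {u = cur _} {v = cur _} 1≤n a∈R
  horizontal-edge {s = suc s} s<n a∈R =
    edge {p = s} {u = nxt _} {v = nxt _} s<n (Equivalence.to (balanced _ _ _) a∈R)

  shift-edge : ∀ {k v c w} → ShiftFits n k (proj₂ v) → ShiftFits n k (proj₂ w) →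
               Edge R n v c w → Edge R n (shiftV k v) c (shiftV k w)
  shift-edge (_ , v≤n) _ (edge {u = cur _} {v = cur _} _ a∈R) = horizontal-edge v≤n a∈R
  shift-edge (_ , v≤n) _ (edge {u = nxt _} {v = nxt _} _ a∈R) =
    horizontal-edge v≤n (Equivalence.from (balanced _ _ _) a∈R)
  shift-edge {k} {c = c} (0≤p+k , _) (_ , w≤n) (edge {p} {cur i} {nxt j} _ a∈R) =
    subst (λ t → Edge R n (i , shiftPos k p) c (j , t)) (sym step)
          (edge {u = cur i} {v = nxt j} (subst (_≤ n) step w≤n) a∈R)
    where
    step : shiftPos k (suc p) ≡ suc (shiftPos k p)
    step = shiftPos-suc k p 0≤p+k
  shift-edge {k} {c = c} (_ , v≤n) (0≤p+k , _) (edge {p} {nxt i} {cur j} _ a∈R) =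
    subst (λ t → Edge R n (i , t) c (j , shiftPos k p)) (sym step)
          (edge {u = nxt i} {v = cur j} (subst (_≤ n) step v≤n) a∈R)
    where
    step : shiftPos k (suc p) ≡ suc (shiftPos k p)
    step = shiftPos-suc k p 0≤p+k

  shift-path : ∀ {k} (ρ : Path N) → All (λ v → ShiftFits n k (proj₂ v)) (vertices ρ) →
               IsPathIn R n ρ → IsPathIn R n (shift k ρ)
  shift-path         (path v [])             ((_ , v≤n) ∷ [])  _        = v≤n
  shift-path {k = k} (path v ((c , w) ∷ st)) (fits-v ∷ fits-ws) (e , ρ′) =
    shift-edge {k} fits-v (All.head fits-ws) e , shift-path {k} (path w st) fits-ws ρ′

vertices-shift : ∀ {N} k (ρ : Path N) → vertices (shift k ρ) ≡ map (shiftV k) (vertices ρ)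
vertices-shift k (path s st) = cong (shiftV k s ∷_) (trans (sym (map-∘ st)) (map-∘ st))

shifted-occurrence : ∀ {N} k p (vs : List (Vertex N)) →
  Any (λ v → proj₂ v ≡ p) (map (shiftV k) vs) ⇔
  (∃[ q ] Any (λ v → proj₂ v ≡ q) vs × shiftPos k q ≡ p)
shifted-occurrence {N} k p vs = mk⇔ (to vs) (from vs)
  where
  to : ∀ vs → Any (λ v → proj₂ v ≡ p) (map (shiftV k) vs) →
       ∃[ q ] Any (λ v → proj₂ v ≡ q) vs × shiftPos k q ≡ p
  to (v ∷ _)  (here v+k≡p) = proj₂ v , here refl , v+k≡p
  to (_ ∷ vs) (there occ)  with to vs occ
  ... | q , q∈vs , q+k≡p = q , there q∈vs , q+k≡p

  from : ∀ vs → (∃[ q ] Any (λ v → proj₂ v ≡ q) vs × shiftPos k q ≡ p) →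
         Any (λ v → proj₂ v ≡ p) (map (shiftV k) vs)
  from (_ ∷ _)  (q , here refl   , q+k≡p) = here q+k≡p
  from (_ ∷ vs) (q , there q∈vs  , q+k≡p) = there (from vs (q , q∈vs , q+k≡p))

positions-shift : ∀ {N} k (ρ : Path N) p →
  (p ∈Pos shift k ρ) ⇔ (∃[ q ] q ∈Pos ρ × shiftPos k q ≡ p)
positions-shift k ρ p rewrite vertices-shift k ρ = shifted-occurrence k p (vertices ρ)

vertex-position : ∀ {N} (ρ : Path N) {v} → v ∈ vertices ρ → proj₂ v ∈Pos ρ
vertex-position ρ = Any.map (λ v≡u → cong proj₂ (sym v≡u))

∃×-cong : ∀ {A B C : ℕ → Set} → (∀ q → A q ⇔ B q) →
          (∃[ q ] A q × C q) ⇔ (∃[ q ] B q × C q)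
∃×-cong A⇔B = mk⇔ (λ (q , a , c) → q , Equivalence.to (A⇔B q) a , c)
                  (λ (q , b , c) → q , Equivalence.from (A⇔B q) b , c)

proposition8 : ∀ {N : ℕ} (R : DBC N) → Balanced R →
    (n : ℕ) → 1 ≤ n →
    (ρ : Path N) → IsPathIn R n ρ →
    (a b : ℕ) → a ≤ b → b ≤ n →
    (∀ (p : ℕ) → (p ∈Pos ρ) ⇔ (a ≤ p × p ≤ b)) →
    (k : ℤ) → - (+ a) ≤ℤ k → k ≤ℤ (+ n) -ℤ (+ b) →
    IsPathIn R n (shift k ρ)
    × (∀ (p : ℕ) → (p ∈Pos shift k ρ) ⇔ ((+ a) +ℤ k ≤ℤ + p × + p ≤ℤ (+ b) +ℤ k))
proposition8 R balanced n 1≤n ρ ρ-path a b _ _ positions k -a≤k k≤n-b =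
  shift-path R balanced n 1≤n {k} ρ all-fit ρ-path , shifted-positions
  where
  all-fit : All (λ v → ShiftFits n k (proj₂ v)) (vertices ρ)
  all-fit = All.tabulate λ v∈ρ →
    interval-fits -a≤k k≤n-b (Equivalence.to (positions _) (vertex-position ρ v∈ρ))

  shifted-positions : ∀ p → (p ∈Pos shift k ρ) ⇔ ((+ a) +ℤ k ≤ℤ + p × + p ≤ℤ (+ b) +ℤ k)
  shifted-positions p =
    ⇔.trans (positions-shift k ρ p) (⇔.trans (∃×-cong positions) (shift-interval -a≤k p))
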